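{- Let $r,p,q$ be positive integers with $p,q$ dividing $r$ and $pq$ dividing $4r$. Assume (i) $q$ is even, and (ii) if $r/p$ is odd then $r/q$ is even and $\frac{4r}{pq}$ is odd. For $j\in\{1,2,3,4\}$ let $t_j=(1,e_j)^{r/2}\in N(r,p,q,4)$, with indices taken modulo 4. Then there exists a unique automorphism $\phi$ of $G(r,p,q,4)$ such that for $i\in\{1,2,3\}$, $\phi(s_i)=t_{i+2}s_i$ if $r/p$ is even and $\phi(s_i)=t_{i+2}s_ic^{\frac{r}{2q}}$ if $r/p$ is odd, and $\phi(x)=x$ for all $x\in N(r,p,q,4)$.
   Context: Let $\zeta_r=\exp(2\pi\sqrt{ -1}/r)$, $\mathbb{Z}_r=\mathbb{Z}/r\mathbb{Z}$. $G(r,n)$ is the group of $n\times n$ complex matrices with exactly one nonzero entry in each row and column, each an $r$th root of unity; elements are written $(\pi,x)$, $\pi\in S_n$, $x\in(\mathbb{Z}_r)^n$, meaning the matrix whose $i$th column has $\zeta_r^{x_i}$ in row $\pi(i)$; $e_1,\dots,e_n$ is the standard basis of $(\mathbb{Z}_r)^n$; permutations $\pi$ are identified with $(\pi,0)$. Put $\Delta(\pi,x)=\sum_ix_i$. For $p\mid r$, $G(r,p,n)=\{g:\Delta(g)\in p\mathbb{Z}_r\}$. Let $c=\zeta_rI_n$; when $p,q\mid r$ and $pq\mid rn$, $C_q=\langle c^{r/q}\rangle$ is central of order $q$ in $G(r,p,n)$ and $G(r,p,q,n)=G(r,p,n)/C_q$ (elements written by representatives). $N(r,p,q,n)$ is the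 image in $G(r,p,q,n)$ of the diagonal matrices. $s_i=(i,i+1)\in S_n$. -}

module Defs where

open import Data.Nat as ℕ using (ℕ; zero; suc)
import Data.Nat.DivMod as ℕD
import Data.Nat.Divisibility as ℕDiv
open import Data.Integer as ℤ using (ℤ; +_; _+_; _-_; _*_; 0ℤ; 1ℤ)
open import Data.Integer.Divisibility using (_∣_)
open import Data.Fin using (Fin; inject₁) renaming (suc to fsuc; zero to fzero)
import Data.Fin as Fin
open import Data.Fin.Permutation as P using (Permutation′; _⟨$⟩ʳ_; _∘ₚ_; transpose)
open import Data.Product using (Σ; ∃; _×_; _,_; proj₁)
open import Relation.Nullary using (¬_; yes; no)
open import Relation.Binary.PropositionalEquality using (_≡_; refl; sym; cong)

-- Total natural-number quotient (m div n = ⌊m/n⌋ for n > 0; unused for n = 0).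
_div_ : ℕ → ℕ → ℕ
m div zero = 0
m div suc n = m ℕD./ suc n

-- Congruence modulo r in ℤ (this is how ℤ_r is modelled).
_≡_[mod_] : ℤ → ℤ → ℕ → Set
x ≡ y [mod r ] = (+ r) ∣ (x - y)

-- Elements (π , x) of G(r,n): π ∈ S_n, x ∈ ℤⁿ read modulo r.
-- The matrix of (π , x) has ζ_r^(x i) in row π(i) of column i.
GElt : ℕ → Set
GElt n = Permutation′ n × (Fin n → ℤ)

perm : ∀ {n} → GElt n → Permutation′ n
perm (π , _) = π

vec : ∀ {n} → GElt n → Fin n → ℤ
vec (_ , x) = x

-- Matrix product: (π,x)(σ,y) = (π∘σ , i ↦ x(σ i) + y i).
-- (σ ∘ₚ π applies σ first, then π.)
mul : ∀ {n} → GElt n → GElt n → GElt n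
mul (π , x) (σ , y) = (σ ∘ₚ π) , (λ i → x (σ ⟨$⟩ʳ i) + y i)

one : ∀ {n} → GElt n
one = P.id , (λ _ → 0ℤ)

pow : ∀ {n} → GElt n → ℕ → GElt n
pow g zero = one
pow g (suc k) = mul g (pow g k)

sumFin : ∀ {n} → (Fin n → ℤ) → ℤ
sumFin {zero} x = 0ℤ
sumFin {suc n} x = x fzero + sumFin (λ i → x (fsuc i))

Δ : ∀ {n} → GElt n → ℤ
Δ g = sumFin (vec g)

e : ∀ {n} → Fin n → Fin n → ℤ
e j i with i Fin.≟ j
... | yes _ = 1ℤ
... | no _ = 0ℤ

permElt : ∀ {n} → Permutation′ n → GElt n
permElt π = π , (λ _ → 0ℤ)

-- c^k = (ζ_r^k) I_n
cpow : ∀ {n} → ℕ → GElt n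
cpow k = P.id , (λ _ → + k)

_≈[_]_ : ∀ {n} → GElt n → ℕ → GElt n → Set
g ≈[ r ] h = (∀ i → perm g ⟨$⟩ʳ i ≡ perm h ⟨$⟩ʳ i)
           × (∀ i → vec g i ≡ vec h i [mod r ])

-- Equality in G(r,p,q,n) = G(r,p,n)/C_q, C_q = ⟨c^(r/q)⟩:
-- g ~ h iff g = h · c^(k·r/q) in G(r,n) for some integer k.
Eq[_,_] : ℕ → ℕ → ∀ {n} → GElt n → GElt n → Set
Eq[ r , q ] g h = Σ ℤ λ k →
  (∀ i → perm g ⟨$⟩ʳ i ≡ perm h ⟨$⟩ʳ i)
  × (∀ i → vec g i ≡ vec h i + k * (+ (r div q)) [mod r ])

InG : ℕ → ℕ → ∀ {n} → GElt n → Set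
InG r p g = Σ ℤ λ k → Δ g ≡ k * (+ p) [mod r ]

-- Representatives of elements of G(r,p,q,n).
Rep : ℕ → ℕ → ℕ → Set
Rep r p n = Σ (GElt n) (InG r p)

-- Membership in N(r,p,q,n): image of the diagonal matrices
-- (permutation part is the identity; invariant under C_q).
InN : ∀ {n} → GElt n → Set
InN g = ∀ i → perm g ⟨$⟩ʳ i ≡ i

-- φ is an automorphism of G(r,p,q,n), given on representatives:
-- well defined, multiplicative, injective and surjective modulo C_q.
record IsAutomorphism (r p q n : ℕ) (φ : Rep r p n → Rep r p n) : Set where
  field
    wellDefined : ∀ g h → Eq[ r , q ] (proj₁ g) (proj₁ h)
                        → Eq[ r , q ] (proj₁ (φ g)) (proj₁ (φ h))
    homomorphism : ∀ g h k → Eq[ r , q ] (proj₁ k) (mul (proj₁ g) (proj₁ h))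
                   → Eq[ r , q ] (proj₁ (φ k)) (mul (proj₁ (φ g)) (proj₁ (φ h)))
    injective : ∀ g h → Eq[ r , q ] (proj₁ (φ g)) (proj₁ (φ h))
                      → Eq[ r , q ] (proj₁ g) (proj₁ h)
    surjective : ∀ (h : Rep r p n) → Σ (Rep r p n) λ g → Eq[ r , q ] (proj₁ (φ g)) (proj₁ h)

-- s_i = (i, i+1) for i ∈ {1,2,3}; index k : Fin 3 stands for i = k+1.
sPerm : Fin 3 → Permutation′ 4
sPerm k = transpose (inject₁ k) (fsuc k)

sElt : Fin 3 → GElt 4
sElt k = permElt (sPerm k)

sInG : ∀ r p k → InG r p (sElt k)
sInG r p k = 0ℤ , (r ℕDiv.∣0)

sRep : ∀ r p → Fin 3 → Rep r p 4
sRep r p k = sElt k , sInG r p k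

tElt : ℕ → Fin 4 → GElt 4
tElt r j = pow (P.id , e j) (r div 2)

-- index i+2 (mod 4) for i = k+1, zero-based: i=1 ↦ t_3, i=2 ↦ t_4, i=3 ↦ t_1
tIdx : Fin 3 → Fin 4
tIdx fzero = fsuc (fsuc fzero)
tIdx (fsuc fzero) = fsuc (fsuc (fsuc fzero))
tIdx (fsuc (fsuc fzero)) = fzero

PhiSpec : (r p q : ℕ) → (Rep r p 4 → Rep r p 4) → Set
PhiSpec r p q φ =
  IsAutomorphism r p q 4 φ
  × (∀ k → (2 ℕDiv.∣ (r div p)
              → Eq[ r , q ] (proj₁ (φ (sRep r p k))) (mul (tElt r (tIdx k)) (sElt k)))
         × (¬ (2 ℕDiv.∣ (r div p))
              → Eq[ r , q ] (proj₁ (φ (sRep r p k)))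
                            (mul (mul (tElt r (tIdx k)) (sElt k)) (cpow (r div (2 ℕ.* q))))))
  × (∀ (x : Rep r p 4) → InN (proj₁ x) → Eq[ r , q ] (proj₁ (φ x)) (proj₁ x))

-- The automorphism is φ(π , x) = (π , x + χ π) with
--   χ π = (r/2) v(π) + S sgn(π) (1,1,1,1),   S = 0 if r/p is even, S = r/(2q) if r/p is odd,
-- where v : S₄ → (ℤ/2)⁴ is the 1-cocycle, well defined modulo constant vectors, with v(s_i) = e_(i+2);
-- on s_i this gives exactly t_(i+2) s_i c^S. Because r/2 and 2S are multiples of r/q, χ is a cocycle
-- modulo C_q, so φ is an endomorphism of G(r,p,q,4); it is inverted by subtracting χ and fixes N since
-- χ(1) ∈ C_q. As Σ v(π) ≡ sgn π (mod 2), the coordinate sum of χ π is (r/2 + 4S) sgn π modulo r, a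
-- multiple of p under the hypotheses, so φ preserves G(r,p,4). The cocycle identities for v are checked
-- by evaluation over S₄. Uniqueness holds because G(r,p,q,4) is generated by N and s₁, s₂, s₃.

module Submission where

open import Defs
open import Level using (0ℓ)
open import Data.Bool using (Bool; true; false; _xor_; _∧_; not)
import Data.Bool.Properties as Bool
open import Data.Fin using (Fin; _≟_) renaming (zero to fzero; suc to fsuc)
open import Data.Fin.Patterns
open import Data.Fin.Properties using (all?)
open import Data.Fin.Permutation as P using (Permutation′; _⟨$⟩ʳ_; _⟨$⟩ˡ_; _∘ₚ_; inverseˡ)
open import Data.Integer as ℤ using (ℤ; +_; _+_; _-_; _*_; -_; 0ℤ; 1ℤ)
import Data.Integer.Properties as ℤ
import Data.Integer.Divisibility.Signed as Signed
open import Data.Integer.Tactic.RingSolver using (solve-∀)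
open import Data.List using (List; []; _∷_)
open import Data.Nat as ℕ using (ℕ; zero; suc; NonZero; _<_)
import Data.Nat.DivMod as ℕ
import Data.Nat.Properties as ℕ
open import Data.Nat.Divisibility using (_∣_; divides; quotient; _∣?_; m%n≡0⇒n∣m)
import Data.Nat.Tactic.RingSolver as ℕ-Solver
open import Data.Product using (Σ; _×_; _,_; proj₁; proj₂)
open import Relation.Binary.Bundles using (Setoid)
import Relation.Binary.Reasoning.Setoid as SetoidReasoning
open import Relation.Binary.PropositionalEquality
  using (_≡_; refl; sym; trans; cong; cong₂; subst; module ≡-Reasoning)
open import Relation.Nullary using (¬_; Dec; does; map′; yes; no; contradiction)
open import Relation.Nullary.Decidable using (True; toWitness; _→-dec_)
open import Relation.Unary using (Decidable)

-- Congruence modulo r, wrapped in a record so that its two sides can be inferred.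
module Modulo (r : ℕ) where

  infix 4 _≋_
  record _≋_ (x y : ℤ) : Set where
    constructor mk≋
    field ≋⇒≡mod : x ≡ y [mod r ]
  open _≋_ public

  private
    via : ∀ {x y u} → x - y ≡ u → + r Signed.∣ u → x ≋ y
    via refl r∣u = mk≋ (Signed.∣⇒∣ᵤ r∣u)

    r∣ : ∀ {x y} → x ≋ y → + r Signed.∣ (x - y)
    r∣ (mk≋ x≡y) = Signed.∣ᵤ⇒∣ x≡y

  ≋-reflexive : ∀ {x y} → x ≡ y → x ≋ y
  ≋-reflexive {x} refl = via (ℤ.+-inverseʳ x) (Signed.divides 0ℤ refl)

  ≋-sym : ∀ {x y} → x ≋ y → y ≋ x
  ≋-sym {x} {y} x≋y = via (flip-minus y x) (Signed.∣m⇒∣-m (r∣ x≋y))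
    where
    flip-minus : ∀ a b → a - b ≡ - (b - a)
    flip-minus = solve-∀

  ≋-trans : ∀ {x y z} → x ≋ y → y ≋ z → x ≋ z
  ≋-trans {x} {y} {z} x≋y y≋z = via (split x y z) (Signed.∣m∣n⇒∣m+n (r∣ x≋y) (r∣ y≋z))
    where
    split : ∀ a b c → a - c ≡ (a - b) + (b - c)
    split = solve-∀

  +-cong : ∀ {a b c d} → a ≋ b → c ≋ d → a + c ≋ b + d
  +-cong {a} {b} {c} {d} a≋b c≋d = via (interchange a b c d) (Signed.∣m∣n⇒∣m+n (r∣ a≋b) (r∣ c≋d))
    where
    interchange : ∀ a b c d → (a + c) - (b + d) ≡ (a - b) + (c - d)
    interchange = solve-∀

  +-congˡ : ∀ a {b c} → b ≋ c → a + b ≋ a + c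
  +-congˡ a = +-cong (≋-reflexive {a} refl)

  +-congʳ : ∀ {a b} c → a ≋ b → a + c ≋ b + c
  +-congʳ c a≋b = +-cong a≋b (≋-reflexive {c} refl)

  -‿cong : ∀ {a b} → a ≋ b → - a ≋ - b
  -‿cong {a} {b} a≋b = via (negate a b) (Signed.∣m⇒∣-m (r∣ a≋b))
    where
    negate : ∀ a b → - a - - b ≡ - (a - b)
    negate = solve-∀

  +-multiple : ∀ x k → x + k * + r ≋ x
  +-multiple x k = via (cancel x k (+ r)) (Signed.divides k refl)
    where
    cancel : ∀ a k m → (a + k * m) - a ≡ k * m
    cancel = solve-∀

  ≋-setoid : Setoid 0ℓ 0ℓ
  ≋-setoid = record
    { Carrier = ℤ
    ; _≈_ = _≋_
    ; isEquivalence = record { refl = ≋-reflexive refl ; sym = ≋-sym ; trans = ≋-trans }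
    }

  module ≋-Reasoning = SetoidReasoning ≋-setoid

≋-scale : ∀ {m n a b} c → c * + m ≡ + n → Modulo._≋_ m a b → Modulo._≋_ n (c * a) (c * b)
≋-scale {m} {n} {a} {b} c cm≡n (Modulo.mk≋ a≡b) with Signed.∣ᵤ⇒∣ a≡b
... | Signed.divides t a-b≡tm = Modulo.mk≋ (Signed.∣⇒∣ᵤ (Signed.divides t (begin
  c * a - c * b   ≡⟨ factor c a b ⟩
  c * (a - b)     ≡⟨ cong (c *_) a-b≡tm ⟩
  c * (t * + m)   ≡⟨ swap c t (+ m) ⟩
  t * (c * + m)   ≡⟨ cong (t *_) cm≡n ⟩
  t * + n         ∎)))
  where
  open ≡-Reasoning
  factor : ∀ c a b → c * a - c * b ≡ c * (a - b)
  factor = solve-∀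
  swap : ∀ c t m → c * (t * m) ≡ t * (c * m)
  swap = solve-∀

private
  shift-zero : ∀ a d → a ≡ a + 0ℤ * d
  shift-zero = solve-∀

  shift-cancel : ∀ a k d → a ≡ a + k * d + (- k) * d
  shift-cancel = solve-∀

  shift-shift : ∀ a k l d → a + k * d + l * d ≡ a + (k + l) * d
  shift-shift = solve-∀

  shift-+ : ∀ a b k l d → (a + k * d) + (b + l * d) ≡ (a + b) + (k + l) * d
  shift-+ = solve-∀

-- Equality in G(r,p,q,n), wrapped so that its two sides can be inferred.
module Quotient (r q : ℕ) {n : ℕ} where
  open Modulo r
  open ≋-Reasoning
  private
    D : ℤ
    D = + (r div q)

  infix 4 _≈_
  record _≈_ (g h : GElt n) : Set where
    constructor mk≈
    field ≈⇒Eq : Eq[ r , q ] g h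
  open _≈_ public

  ≈-intro : {g h : GElt n} (k : ℤ) → (∀ i → perm g ⟨$⟩ʳ i ≡ perm h ⟨$⟩ʳ i) →
            (∀ i → vec g i ≋ vec h i + k * D) → g ≈ h
  ≈-intro k π≗σ x≋y = mk≈ (k , π≗σ , λ i → ≋⇒≡mod (x≋y i))

  shift : {g h : GElt n} → g ≈ h → ℤ
  shift (mk≈ (k , _)) = k

  ≈⇒perm : {g h : GElt n} → g ≈ h → ∀ i → perm g ⟨$⟩ʳ i ≡ perm h ⟨$⟩ʳ i
  ≈⇒perm (mk≈ (_ , π≗σ , _)) = π≗σ

  ≈⇒vec : {g h : GElt n} (g≈h : g ≈ h) → ∀ i → vec g i ≋ vec h i + shift g≈h * D
  ≈⇒vec (mk≈ (_ , _ , x≋y)) i = mk≋ (x≋y i)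

  ≈-refl : {g : GElt n} → g ≈ g
  ≈-refl {g} = ≈-intro 0ℤ (λ _ → refl) λ i → ≋-reflexive (shift-zero (vec g i) D)

  ≈-sym : {g h : GElt n} → g ≈ h → h ≈ g
  ≈-sym {g} {h} g≈h = ≈-intro (- k) (λ i → sym (≈⇒perm g≈h i)) λ i → begin
    vec h i                        ≡⟨ shift-cancel (vec h i) k D ⟩
    vec h i + k * D + (- k) * D    ≈⟨ +-congʳ ((- k) * D) (≋-sym (≈⇒vec g≈h i)) ⟩
    vec g i + (- k) * D            ∎
    where k = shift g≈h

  ≈-trans : {g h l : GElt n} → g ≈ h → h ≈ l → g ≈ l
  ≈-trans {g} {h} {l} g≈h h≈l =
    ≈-intro (k′ + k) (λ i → trans (≈⇒perm g≈h i) (≈⇒perm h≈l i)) λ i → begin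
      vec g i                       ≈⟨ ≈⇒vec g≈h i ⟩
      vec h i + k * D               ≈⟨ +-congʳ (k * D) (≈⇒vec h≈l i) ⟩
      vec l i + k′ * D + k * D      ≡⟨ shift-shift (vec l i) k′ k D ⟩
      vec l i + (k′ + k) * D        ∎
    where k = shift g≈h; k′ = shift h≈l

  mul-cong : {g g′ h h′ : GElt n} → g ≈ g′ → h ≈ h′ → mul g h ≈ mul g′ h′
  mul-cong {π , x} {π′ , x′} {σ , y} {σ′ , y′} g≈g′ h≈h′ =
    ≈-intro (k + l) (λ i → trans (cong (π ⟨$⟩ʳ_) (σ≗σ′ i)) (≈⇒perm g≈g′ (σ′ ⟨$⟩ʳ i))) λ i → begin
      x (σ ⟨$⟩ʳ i) + y i
        ≈⟨ +-cong (≈⇒vec g≈g′ (σ ⟨$⟩ʳ i)) (≈⇒vec h≈h′ i) ⟩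
      (x′ (σ ⟨$⟩ʳ i) + k * D) + (y′ i + l * D)
        ≡⟨ shift-+ (x′ (σ ⟨$⟩ʳ i)) (y′ i) k l D ⟩
      x′ (σ ⟨$⟩ʳ i) + y′ i + (k + l) * D
        ≡⟨ cong (λ j → x′ j + y′ i + (k + l) * D) (σ≗σ′ i) ⟩
      x′ (σ′ ⟨$⟩ʳ i) + y′ i + (k + l) * D
        ∎
    where
    k = shift g≈g′
    l = shift h≈h′
    σ≗σ′ = ≈⇒perm h≈h′

  mul-identityʳ : (g : GElt n) → mul g one ≈ g
  mul-identityʳ (π , x) = ≈-intro 0ℤ (λ _ → refl) λ i → ≋-reflexive (pad (x i) D)
    where
    pad : ∀ a d → a + 0ℤ ≡ a + 0ℤ * d
    pad = solve-∀

  ≈-setoid : Setoid 0ℓ 0ℓ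
  ≈-setoid = record
    { Carrier = GElt n
    ; _≈_ = _≈_
    ; isEquivalence = record { refl = ≈-refl ; sym = ≈-sym ; trans = ≈-trans }
    }

sumFin-+ : ∀ {n} (x y : Fin n → ℤ) → sumFin (λ i → x i + y i) ≡ sumFin x + sumFin y
sumFin-+ {zero} x y = refl
sumFin-+ {suc n} x y = trans (cong (_+_ (x fzero + y fzero)) (sumFin-+ (λ i → x (fsuc i)) (λ i → y (fsuc i))))
                             (interchange (x fzero) (y fzero) _ _)
  where
  interchange : ∀ a b c d → a + b + (c + d) ≡ a + c + (b + d)
  interchange = solve-∀

sumFin-neg : ∀ {n} (x : Fin n → ℤ) → sumFin (λ i → - x i) ≡ - sumFin x
sumFin-neg {zero} x = refl
sumFin-neg {suc n} x = trans (cong (_+_ (- x fzero)) (sumFin-neg (λ i → x (fsuc i))))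
                             (sym (ℤ.neg-distrib-+ (x fzero) _))

sumFin-zero : ∀ {n} (x : Fin n → ℤ) → (∀ i → x i ≡ 0ℤ) → sumFin x ≡ 0ℤ
sumFin-zero {zero} x x≗0 = refl
sumFin-zero {suc n} x x≗0 = cong₂ _+_ (x≗0 fzero) (sumFin-zero (λ i → x (fsuc i)) (λ i → x≗0 (fsuc i)))

module _ (r p : ℕ) {n : ℕ} where
  open Modulo r
  open ≋-Reasoning

  InG-+ : ∀ (g h : GElt n) → InG r p g → InG r p h → InG r p (perm g , λ i → vec g i + vec h i)
  InG-+ (_ , x) (_ , y) (k , Σx≡kp) (l , Σy≡lp) = k + l , ≋⇒≡mod (begin
    sumFin (λ i → x i + y i)   ≡⟨ sumFin-+ x y ⟩
    sumFin x + sumFin y        ≈⟨ +-cong Σx≋kp Σy≋lp ⟩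
    k * + p + l * + p          ≡⟨ ℤ.*-distribʳ-+ (+ p) k l ⟨
    (k + l) * + p              ∎)
    where
    Σx≋kp : sumFin x ≋ k * + p
    Σx≋kp = mk≋ Σx≡kp
    Σy≋lp : sumFin y ≋ l * + p
    Σy≋lp = mk≋ Σy≡lp

  InG-neg : ∀ (g : GElt n) → InG r p g → InG r p (perm g , λ i → - vec g i)
  InG-neg (_ , x) (k , Σx≡kp) = - k , ≋⇒≡mod (begin
    sumFin (λ i → - x i)   ≡⟨ sumFin-neg x ⟩
    - sumFin x             ≈⟨ -‿cong Σx≋kp ⟩
    - (k * + p)            ≡⟨ ℤ.neg-distribˡ-* k (+ p) ⟩
    - k * + p              ∎)
    where
    Σx≋kp : sumFin x ≋ k * + p
    Σx≋kp = mk≋ Σx≡kp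

  InG-zero : ∀ (g : GElt n) → (∀ i → vec g i ≡ 0ℤ) → InG r p g
  InG-zero g x≗0 = 0ℤ , ≋⇒≡mod (≋-reflexive (sumFin-zero (vec g) x≗0))

-- Twisting by a cocycle

module Twist {r p q n : ℕ} (χ : Permutation′ n → Fin n → ℤ)
  (χ-cong : ∀ {π σ} → (∀ i → π ⟨$⟩ʳ i ≡ σ ⟨$⟩ʳ i) → ∀ i → χ π i ≡ χ σ i)
  (χ-cocycle : ∀ π σ → Σ ℤ λ k → ∀ i →
     Modulo._≋_ r (χ (σ ∘ₚ π) i) (χ π (σ ⟨$⟩ʳ i) + χ σ i + k * + (r div q)))
  (χ-InG : ∀ π → InG r p (P.id , χ π)) where

  open Modulo r
  open ≋-Reasoning
  open Quotient r q {n}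
  private
    D : ℤ
    D = + (r div q)

  twist untwist : GElt n → GElt n
  twist (π , x) = π , λ i → x i + χ π i
  untwist (π , x) = π , λ i → x i - χ π i

  twistRep untwistRep : Rep r p n → Rep r p n
  twistRep ((π , x) , g∈G) = twist (π , x) , InG-+ r p (π , x) (P.id , χ π) g∈G (χ-InG π)
  untwistRep ((π , x) , g∈G) =
    untwist (π , x) , InG-+ r p (π , x) (P.id , λ i → - χ π i) g∈G (InG-neg r p (P.id , χ π) (χ-InG π))

  twist-cong : ∀ {g h} → g ≈ h → twist g ≈ twist h
  twist-cong {π , x} {σ , y} g≈h = ≈-intro k (≈⇒perm g≈h) λ i → begin
    x i + χ π i             ≡⟨ cong (_+_ (x i)) (χ-cong (≈⇒perm g≈h) i) ⟩
    x i + χ σ i             ≈⟨ +-congʳ (χ σ i) (≈⇒vec g≈h i) ⟩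
    y i + k * D + χ σ i     ≡⟨ swap (y i) (k * D) (χ σ i) ⟩
    y i + χ σ i + k * D     ∎
    where
    k = shift g≈h
    swap : ∀ a b c → a + b + c ≡ a + c + b
    swap = solve-∀

  twist-cancel : ∀ {g h} → twist g ≈ twist h → g ≈ h
  twist-cancel {π , x} {σ , y} tg≈th = ≈-intro k π≗σ λ i → begin
    x i                             ≡⟨ add-sub (x i) (χ π i) ⟩
    x i + χ π i - χ π i             ≈⟨ +-cong (≈⇒vec tg≈th i) (≋-reflexive (cong -_ (χ-cong π≗σ i))) ⟩
    y i + χ σ i + k * D - χ σ i     ≡⟨ cancel (y i) (χ σ i) (k * D) ⟩
    y i + k * D                     ∎
    where
    k = shift tg≈th
    π≗σ = ≈⇒perm tg≈th
    add-sub : ∀ a c → a ≡ a + c - c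
    add-sub = solve-∀
    cancel : ∀ a c b → a + c + b - c ≡ a + b
    cancel = solve-∀

  twist-untwist : ∀ g → twist (untwist g) ≈ g
  twist-untwist (π , x) = ≈-intro 0ℤ (λ _ → refl) λ i → ≋-reflexive (sub-add (x i) (χ π i) D)
    where
    sub-add : ∀ a c d → a - c + c ≡ a + 0ℤ * d
    sub-add = solve-∀

  twist-mul : ∀ {g h k} → k ≈ mul g h → twist k ≈ mul (twist g) (twist h)
  twist-mul {π , x} {σ , y} {ρ , z} k≈gh = ≈-intro (j + l) (≈⇒perm k≈gh) λ i → begin
    z i + χ ρ i
      ≡⟨ cong (_+_ (z i)) (χ-cong (≈⇒perm k≈gh) i) ⟩
    z i + χ (σ ∘ₚ π) i
      ≈⟨ +-cong (≈⇒vec k≈gh i) (χ-σπ i) ⟩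
    (x (σ ⟨$⟩ʳ i) + y i + j * D) + (χ π (σ ⟨$⟩ʳ i) + χ σ i + l * D)
      ≡⟨ regroup (x (σ ⟨$⟩ʳ i)) (y i) (χ π (σ ⟨$⟩ʳ i)) (χ σ i) j l D ⟩
    (x (σ ⟨$⟩ʳ i) + χ π (σ ⟨$⟩ʳ i)) + (y i + χ σ i) + (j + l) * D
      ∎
    where
    j = shift k≈gh
    l = proj₁ (χ-cocycle π σ)
    χ-σπ = proj₂ (χ-cocycle π σ)
    regroup : ∀ a b c d j l D → (a + b + j * D) + (c + d + l * D) ≡ (a + c) + (b + d) + (j + l) * D
    regroup = solve-∀

  -- The cocycle identity at (id, id) forces χ id to be a constant multiple of r/q modulo r.
  χ-id : Σ ℤ λ k → ∀ i → χ P.id i ≋ k * D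
  χ-id = - l , λ i → let c = χ P.id i in begin
    c                                        ≡⟨ expand c (l * D) ⟩
    (c + c + l * D) + (- c - l * D)          ≈⟨ +-congʳ (- c - l * D) (≋-sym (χ-idid i)) ⟩
    χ (P.id ∘ₚ P.id) i + (- c - l * D)       ≡⟨ cong (_+ (- c - l * D)) (χ-cong (λ _ → refl) i) ⟩
    c + (- c - l * D)                        ≡⟨ collapse c l D ⟩
    - l * D                                  ∎
    where
    l = proj₁ (χ-cocycle P.id P.id)
    χ-idid = proj₂ (χ-cocycle P.id P.id)
    expand : ∀ c e → c ≡ (c + c + e) + (- c - e)
    expand = solve-∀
    collapse : ∀ c l D → c + (- c - l * D) ≡ - l * D
    collapse = solve-∀

  twist-diagonal : ∀ g → InN g → twist g ≈ g
  twist-diagonal (π , x) π≗id = ≈-intro (proj₁ χ-id) (λ _ → refl) λ i → begin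
    x i + χ π i          ≡⟨ cong (_+_ (x i)) (χ-cong π≗id i) ⟩
    x i + χ P.id i       ≈⟨ +-congˡ (x i) (proj₂ χ-id i) ⟩
    x i + proj₁ χ-id * D ∎

  twist-isAutomorphism : IsAutomorphism r p q n twistRep
  twist-isAutomorphism = record
    { wellDefined = λ g h g≈h → ≈⇒Eq (twist-cong {proj₁ g} {proj₁ h} (mk≈ g≈h))
    ; homomorphism = λ g h k k≈gh → ≈⇒Eq (twist-mul {proj₁ g} {proj₁ h} {proj₁ k} (mk≈ k≈gh))
    ; injective = λ g h tg≈th → ≈⇒Eq (twist-cancel {proj₁ g} {proj₁ h} (mk≈ tg≈th))
    ; surjective = λ h → untwistRep h , ≈⇒Eq (twist-untwist (proj₁ h))
    }

-- The cocycle on S₄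

Table : Set
Table = Fin 4 × Fin 4 × Fin 4 × Fin 4

infixl 9 _⟪_⟫
_⟪_⟫ : Table → Fin 4 → Fin 4
(a , b , c , d) ⟪ 0F ⟫ = a
(a , b , c , d) ⟪ 1F ⟫ = b
(a , b , c , d) ⟪ 2F ⟫ = c
(a , b , c , d) ⟪ 3F ⟫ = d

tabulate : (Fin 4 → Fin 4) → Table
tabulate f = f 0F , f 1F , f 2F , f 3F

_∘ᵗ_ : Table → Table → Table
a ∘ᵗ b = tabulate λ i → a ⟪ b ⟪ i ⟫ ⟫

table : Permutation′ 4 → Table
table π = tabulate (π ⟨$⟩ʳ_)

table-⟪⟫ : ∀ π i → table π ⟪ i ⟫ ≡ π ⟨$⟩ʳ i
table-⟪⟫ π 0F = refl
table-⟪⟫ π 1F = refl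
table-⟪⟫ π 2F = refl
table-⟪⟫ π 3F = refl

table-cong : ∀ {π σ} → (∀ i → π ⟨$⟩ʳ i ≡ σ ⟨$⟩ʳ i) → table π ≡ table σ
table-cong π≗σ rewrite π≗σ 0F | π≗σ 1F | π≗σ 2F | π≗σ 3F = refl

table-∘ : ∀ π σ → table (σ ∘ₚ π) ≡ table π ∘ᵗ table σ
table-∘ π σ rewrite table-⟪⟫ σ 0F | table-⟪⟫ σ 1F | table-⟪⟫ σ 2F | table-⟪⟫ σ 3F
                  | table-⟪⟫ π (σ ⟨$⟩ʳ 0F) | table-⟪⟫ π (σ ⟨$⟩ʳ 1F)
                  | table-⟪⟫ π (σ ⟨$⟩ʳ 2F) | table-⟪⟫ π (σ ⟨$⟩ʳ 3F) = refl

Injective : Table → Set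
Injective t = ∀ i j → t ⟪ i ⟫ ≡ t ⟪ j ⟫ → i ≡ j

injective? : Decidable Injective
injective? t = all? λ i → all? λ j → (t ⟪ i ⟫ ≟ t ⟪ j ⟫) →-dec (i ≟ j)

table-injective : ∀ π → Injective (table π)
table-injective π i j πi≡πj = begin
  i                          ≡⟨ inverseˡ π ⟨
  π ⟨$⟩ˡ (π ⟨$⟩ʳ i)          ≡⟨ cong (π ⟨$⟩ˡ_) (table-⟪⟫ π i) ⟨
  π ⟨$⟩ˡ (table π ⟪ i ⟫)     ≡⟨ cong (π ⟨$⟩ˡ_) πi≡πj ⟩
  π ⟨$⟩ˡ (table π ⟪ j ⟫)     ≡⟨ cong (π ⟨$⟩ˡ_) (table-⟪⟫ π j) ⟩
  π ⟨$⟩ˡ (π ⟨$⟩ʳ j)          ≡⟨ inverseˡ π ⟩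
  j                          ∎
  where open ≡-Reasoning

all-tables? : {P : Table → Set} → Decidable P → Dec (∀ t → P t)
all-tables? P? = map′ (λ h (a , b , c , d) → h a b c d) (λ h a b c d → h (a , b , c , d))
  (all? λ a → all? λ b → all? λ c → all? λ d → P? (a , b , c , d))

by-exhaustion : {P : Table → Set} (P? : Decidable P) → {True (all-tables? P?)} → ∀ t → P t
by-exhaustion P? {holds} = toWitness holds

-- The letter k : Fin 3 stands for s_(k+1); act w i applies the product of w to i.
act : List (Fin 3) → Fin 4 → Fin 4
act [] i = i
act (k ∷ w) i = sPerm k ⟨$⟩ʳ act w i

-- A word for each of the 24 permutation tables (junk [] on the others).
word : Table → List (Fin 3)
word (0F , 1F , 2F , 3F) = []
word (0F , 1F , 3F , 2F) = 2F ∷ []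
word (0F , 2F , 1F , 3F) = 1F ∷ []
word (0F , 2F , 3F , 1F) = 1F ∷ 2F ∷ []
word (0F , 3F , 1F , 2F) = 2F ∷ 1F ∷ []
word (0F , 3F , 2F , 1F) = 1F ∷ 2F ∷ 1F ∷ []
word (1F , 0F , 2F , 3F) = 0F ∷ []
word (1F , 0F , 3F , 2F) = 2F ∷ 0F ∷ []
word (1F , 2F , 0F , 3F) = 0F ∷ 1F ∷ []
word (1F , 2F , 3F , 0F) = 0F ∷ 1F ∷ 2F ∷ []
word (1F , 3F , 0F , 2F) = 2F ∷ 0F ∷ 1F ∷ []
word (1F , 3F , 2F , 0F) = 0F ∷ 1F ∷ 2F ∷ 1F ∷ []
word (2F , 0F , 1F , 3F) = 1F ∷ 0F ∷ []
word (2F , 0F , 3F , 1F) = 1F ∷ 2F ∷ 0F ∷ []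
word (2F , 1F , 0F , 3F) = 0F ∷ 1F ∷ 0F ∷ []
word (2F , 1F , 3F , 0F) = 0F ∷ 1F ∷ 2F ∷ 0F ∷ []
word (2F , 3F , 0F , 1F) = 1F ∷ 2F ∷ 0F ∷ 1F ∷ []
word (2F , 3F , 1F , 0F) = 0F ∷ 1F ∷ 2F ∷ 0F ∷ 1F ∷ []
word (3F , 0F , 1F , 2F) = 2F ∷ 1F ∷ 0F ∷ []
word (3F , 0F , 2F , 1F) = 1F ∷ 2F ∷ 1F ∷ 0F ∷ []
word (3F , 1F , 0F , 2F) = 2F ∷ 0F ∷ 1F ∷ 0F ∷ []
word (3F , 1F , 2F , 0F) = 0F ∷ 1F ∷ 2F ∷ 1F ∷ 0F ∷ []
word (3F , 2F , 0F , 1F) = 1F ∷ 2F ∷ 0F ∷ 1F ∷ 0F ∷ []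
word (3F , 2F , 1F , 0F) = 0F ∷ 1F ∷ 2F ∷ 0F ∷ 1F ∷ 0F ∷ []
word _ = []

word-act : ∀ t → Injective t → ∀ i → act (word t) i ≡ t ⟪ i ⟫
word-act = by-exhaustion λ t → injective? t →-dec all? λ i → act (word t) i ≟ t ⟪ i ⟫

-- The cocycle v with v(s_k) = e_(k+2), computed along words by v(s_k w) = v(s_k) ∘ w + v(w).
flipsʷ : List (Fin 3) → Fin 4 → Bool
flipsʷ [] i = false
flipsʷ (k ∷ w) i = does (act w i ≟ tIdx k) xor flipsʷ w i

parityʷ : List (Fin 3) → Bool
parityʷ [] = false
parityʷ (k ∷ w) = not (parityʷ w)

flips : Table → Fin 4 → Bool
flips t = flipsʷ (word t)

odd : Table → Bool
odd t = parityʷ (word t)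

-- v is a cocycle only modulo constant vectors; defect a b is the constant, read off at index 0.
defect : Table → Table → Bool
defect a b = flips (a ∘ᵗ b) 0F xor flips a (b ⟪ 0F ⟫) xor flips b 0F

flips-cocycle : ∀ a → Injective a → ∀ b → Injective b →
  ∀ i → flips (a ∘ᵗ b) i ≡ flips a (b ⟪ i ⟫) xor flips b i xor defect a b
flips-cocycle = by-exhaustion λ a → injective? a →-dec all-tables? λ b → injective? b →-dec
  all? λ i → flips (a ∘ᵗ b) i Bool.≟ flips a (b ⟪ i ⟫) xor flips b i xor defect a b

odd-∘ : ∀ a → Injective a → ∀ b → Injective b → odd (a ∘ᵗ b) ≡ odd a xor odd b
odd-∘ = by-exhaustion λ a → injective? a →-dec all-tables? λ b → injective? b →-dec
  (odd (a ∘ᵗ b) Bool.≟ odd a xor odd b)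

flips-sum : ∀ t → Injective t → flips t 0F xor flips t 1F xor flips t 2F xor flips t 3F ≡ odd t
flips-sum = by-exhaustion λ t → injective? t →-dec (_ Bool.≟ odd t)

perm-pow-diagonal : ∀ {n} (y : Fin n → ℤ) m i → perm (pow (P.id , y) m) ⟨$⟩ʳ i ≡ i
perm-pow-diagonal y zero i = refl
perm-pow-diagonal y (suc m) i = perm-pow-diagonal y m i

vec-pow-diagonal : ∀ {n} (y : Fin n → ℤ) m i → vec (pow (P.id , y) m) i ≡ + m * y i
vec-pow-diagonal y zero i = refl
vec-pow-diagonal y (suc m) i
  rewrite perm-pow-diagonal y m i | vec-pow-diagonal y m i = add-one (y i) (+ m)
  where
  add-one : ∀ a m → a + m * a ≡ (1ℤ + m) * a
  add-one = solve-∀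

bit : Bool → ℤ
bit false = 0ℤ
bit true = 1ℤ

bit-xor : ∀ x y → bit (x xor y) ≡ bit x + bit y + - bit (x ∧ y) * + 2
bit-xor false false = refl
bit-xor false true = refl
bit-xor true false = refl
bit-xor true true = refl

bit-xor-mod2 : ∀ x y → Modulo._≋_ 2 (bit (x xor y)) (bit x + bit y)
bit-xor-mod2 x y = ≋-trans (≋-reflexive (bit-xor x y)) (+-multiple (bit x + bit y) (- bit (x ∧ y)))
  where open Modulo 2

bit-xor₃ : ∀ x y z → Modulo._≋_ 2 (bit (x xor y xor z)) (bit x + (bit y + bit z))
bit-xor₃ x y z = ≋-trans (bit-xor-mod2 x (y xor z)) (+-congˡ (bit x) (bit-xor-mod2 y z))
  where open Modulo 2

bit-xor₄ : ∀ w x y z → Modulo._≋_ 2 (bit (w xor x xor y xor z)) (bit w + (bit x + (bit y + bit z)))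
bit-xor₄ w x y z = ≋-trans (bit-xor-mod2 w (x xor y xor z)) (+-congˡ (bit w) (bit-xor₃ x y z))
  where open Modulo 2

flips-generator : ∀ k i → bit (flips (table (sPerm k)) i) ≡ e (tIdx k) (sPerm k ⟨$⟩ʳ i)
flips-generator 0F 0F = refl
flips-generator 0F 1F = refl
flips-generator 0F 2F = refl
flips-generator 0F 3F = refl
flips-generator 1F 0F = refl
flips-generator 1F 1F = refl
flips-generator 1F 2F = refl
flips-generator 1F 3F = refl
flips-generator 2F 0F = refl
flips-generator 2F 1F = refl
flips-generator 2F 2F = refl
flips-generator 2F 3F = refl

odd-generator : ∀ k → odd (table (sPerm k)) ≡ true
odd-generator 0F = refl
odd-generator 1F = refl
odd-generator 2F = refl

-- With H = r/2: 2H = r and H, 2S ∈ (r/q)ℤ make χ a cocycle modulo C_q; H + 4S ∈ pℤ keeps G(r,p,4).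
record TwistParameters (r p q : ℕ) (S : ℤ) : Set where
  field
    η δ τ : ℤ
    r≡H+H : + r ≡ + (r div 2) + + (r div 2)
    H≡ηD : + (r div 2) ≡ η * + (r div q)
    S+S≡δD : S + S ≡ δ * + (r div q)
    H+4S≡τp : + (r div 2) + S * + 4 ≡ τ * + p

module S₄Twist {r p q : ℕ} {S : ℤ} (params : TwistParameters r p q S) where

  open TwistParameters params
  open Modulo r
  private
    H D : ℤ
    H = + (r div 2)
    D = + (r div q)

  χ : Permutation′ 4 → Fin 4 → ℤ
  χ π i = H * bit (flips (table π) i) + S * bit (odd (table π))

  χ-cong : ∀ {π σ} → (∀ i → π ⟨$⟩ʳ i ≡ σ ⟨$⟩ʳ i) → ∀ i → χ π i ≡ χ σ i
  χ-cong {π} {σ} π≗σ i = cong (λ t → H * bit (flips t i) + S * bit (odd t)) (table-cong {π} {σ} π≗σ)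

  private
    H-scale : ∀ {a b} → Modulo._≋_ 2 a b → H * a ≋ H * b
    H-scale = ≋-scale H (trans (double H) (sym r≡H+H))
      where
      double : ∀ h → h * + 2 ≡ h + h
      double = solve-∀

    regroup : ∀ fa fb d oa ob o →
      H * (fa + (fb + d)) + S * (oa + ob + - o * + 2)
      ≡ (H * fa + S * oa) + (H * fb + S * ob) + (η * d + - (δ * o)) * D
    regroup fa fb d oa ob o = begin
      H * (fa + (fb + d)) + S * (oa + ob + - o * + 2)
        ≡⟨ split H S fa fb d oa ob o ⟩
      (H * fa + S * oa) + (H * fb + S * ob) + (H * d + - (o * (S + S)))
        ≡⟨ cong₂ (λ u v → (H * fa + S * oa) + (H * fb + S * ob) + (u * d + - (o * v))) H≡ηD S+S≡δD ⟩
      (H * fa + S * oa) + (H * fb + S * ob) + (η * D * d + - (o * (δ * D)))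
        ≡⟨ factor-D (H * fa + S * oa) (H * fb + S * ob) η δ d o D ⟩
      (H * fa + S * oa) + (H * fb + S * ob) + (η * d + - (δ * o)) * D
        ∎
      where
      open ≡-Reasoning
      split : ∀ H S fa fb d oa ob o → H * (fa + (fb + d)) + S * (oa + ob + - o * + 2)
                ≡ (H * fa + S * oa) + (H * fb + S * ob) + (H * d + - (o * (S + S)))
      split = solve-∀
      factor-D : ∀ x y η δ d o D → x + y + (η * D * d + - (o * (δ * D))) ≡ x + y + (η * d + - (δ * o)) * D
      factor-D = solve-∀

  χ-cocycle : ∀ π σ → Σ ℤ λ k → ∀ i → χ (σ ∘ₚ π) i ≋ χ π (σ ⟨$⟩ʳ i) + χ σ i + k * D
  χ-cocycle π σ = k , λ i → begin
    χ (σ ∘ₚ π) i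
      ≡⟨ cong (λ t → H * bit (flips t i) + S * bit (odd t)) (table-∘ π σ) ⟩
    H * bit (flips (a ∘ᵗ b) i) + S * bit (odd (a ∘ᵗ b))
      ≡⟨ cong₂ (λ u v → H * bit u + S * bit v) (flips-cocycle a a-inj b b-inj i) (odd-∘ a a-inj b b-inj) ⟩
    H * bit (flips a (b ⟪ i ⟫) xor flips b i xor defect a b) + S * bit (odd a xor odd b)
      ≈⟨ +-cong (H-scale (bit-xor₃ (flips a (b ⟪ i ⟫)) (flips b i) (defect a b)))
                (≋-reflexive (cong (S *_) (bit-xor (odd a) (odd b)))) ⟩
    H * (bit (flips a (b ⟪ i ⟫)) + (bit (flips b i) + bit (defect a b)))
      + S * (bit (odd a) + bit (odd b) + - bit (odd a ∧ odd b) * + 2)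
      ≡⟨ regroup (bit (flips a (b ⟪ i ⟫))) (bit (flips b i)) (bit (defect a b))
                 (bit (odd a)) (bit (odd b)) (bit (odd a ∧ odd b)) ⟩
    (H * bit (flips a (b ⟪ i ⟫)) + S * bit (odd a)) + (H * bit (flips b i) + S * bit (odd b))
      + k * D
      ≡⟨ cong (λ j → (H * bit (flips a j) + S * bit (odd a)) + χ σ i + k * D) (table-⟪⟫ σ i) ⟩
    χ π (σ ⟨$⟩ʳ i) + χ σ i + k * D
      ∎
    where
    a = table π
    b = table σ
    a-inj = table-injective π
    b-inj = table-injective σ
    k = η * bit (defect a b) + - (δ * bit (odd a ∧ odd b))
    open ≋-Reasoning

  χ-InG : ∀ π → InG r p (P.id , χ π)
  χ-InG π = τ * o , ≋⇒≡mod (begin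
    (H * f 0F + S * o) + ((H * f 1F + S * o) + ((H * f 2F + S * o) + ((H * f 3F + S * o) + 0ℤ)))
      ≡⟨ collect H S (f 0F) (f 1F) (f 2F) (f 3F) o ⟩
    H * (f 0F + (f 1F + (f 2F + f 3F))) + S * + 4 * o
      ≈⟨ +-congʳ (S * + 4 * o) (H-scale sum≋odd) ⟩
    H * o + S * + 4 * o
      ≡⟨ combine H S o ⟩
    (H + S * + 4) * o
      ≡⟨ cong (_* o) H+4S≡τp ⟩
    τ * + p * o
      ≡⟨ swap τ (+ p) o ⟩
    τ * o * + p
      ∎)
    where
    open ≋-Reasoning
    t = table π
    f : Fin 4 → ℤ
    f i = bit (flips t i)
    o = bit (odd t)
    sum≋odd : Modulo._≋_ 2 (f 0F + (f 1F + (f 2F + f 3F))) o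
    sum≋odd = Modulo.≋-sym 2 (Modulo.≋-trans 2
      (Modulo.≋-reflexive 2 (cong bit (sym (flips-sum t (table-injective π)))))
      (bit-xor₄ (flips t 0F) (flips t 1F) (flips t 2F) (flips t 3F)))
    collect : ∀ H S a b c d o → (H * a + S * o) + ((H * b + S * o) + ((H * c + S * o) + ((H * d + S * o) + 0ℤ)))
                                ≡ H * (a + (b + (c + d))) + S * + 4 * o
    collect = solve-∀
    combine : ∀ H S o → H * o + S * + 4 * o ≡ (H + S * + 4) * o
    combine = solve-∀
    swap : ∀ a b c → a * b * c ≡ a * c * b
    swap = solve-∀

  open Twist {r} {p} {q} χ (λ {π} {σ} → χ-cong {π} {σ}) χ-cocycle χ-InG public
  open Quotient r q

  twist-generator : ∀ k → twist (sElt k) ≈ mul (mul (tElt r (tIdx k)) (sElt k)) (P.id , λ _ → S)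
  twist-generator k = ≈-intro 0ℤ (λ i → sym (perm-pow-diagonal (e j) (r div 2) (sPerm k ⟨$⟩ʳ i))) λ i → begin
    0ℤ + χ (sPerm k) i
      ≡⟨ cong₂ (λ u v → 0ℤ + (H * u + S * bit v)) (flips-generator k i) (odd-generator k) ⟩
    0ℤ + (H * e j (sPerm k ⟨$⟩ʳ i) + S * 1ℤ)
      ≡⟨ rearrange H (e j (sPerm k ⟨$⟩ʳ i)) S D ⟩
    H * e j (sPerm k ⟨$⟩ʳ i) + 0ℤ + S + 0ℤ * D
      ≡⟨ cong (λ u → u + 0ℤ + S + 0ℤ * D) (vec-pow-diagonal (e j) (r div 2) (sPerm k ⟨$⟩ʳ i)) ⟨
    vec (tElt r j) (sPerm k ⟨$⟩ʳ i) + 0ℤ + S + 0ℤ * D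
      ∎
    where
    j = tIdx k
    open ≋-Reasoning
    rearrange : ∀ H a S D → 0ℤ + (H * a + S * 1ℤ) ≡ H * a + 0ℤ + S + 0ℤ * D
    rearrange = solve-∀

-- Uniqueness

module Agreement {r p q n : ℕ} {ψ φ : Rep r p n → Rep r p n}
  (ψ-aut : IsAutomorphism r p q n ψ) (φ-aut : IsAutomorphism r p q n φ) where

  open Quotient r q {n}
  open SetoidReasoning ≈-setoid
  private
    module ψ = IsAutomorphism ψ-aut
    module φ = IsAutomorphism φ-aut

  Agree : Rep r p n → Set
  Agree g = proj₁ (ψ g) ≈ proj₁ (φ g)

  agree-≈ : ∀ g h → proj₁ g ≈ proj₁ h → Agree h → Agree g
  agree-≈ g h g≈h h-agrees = begin
    proj₁ (ψ g)  ≈⟨ mk≈ (ψ.wellDefined g h (≈⇒Eq g≈h)) ⟩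
    proj₁ (ψ h)  ≈⟨ h-agrees ⟩
    proj₁ (φ h)  ≈⟨ mk≈ (φ.wellDefined h g (≈⇒Eq (≈-sym g≈h))) ⟩
    proj₁ (φ g)  ∎

  agree-mul : ∀ g h k → proj₁ k ≈ mul (proj₁ g) (proj₁ h) → Agree g → Agree h → Agree k
  agree-mul g h k k≈gh g-agrees h-agrees = begin
    proj₁ (ψ k)                          ≈⟨ mk≈ (ψ.homomorphism g h k (≈⇒Eq k≈gh)) ⟩
    mul (proj₁ (ψ g)) (proj₁ (ψ h))      ≈⟨ mul-cong g-agrees h-agrees ⟩
    mul (proj₁ (φ g)) (proj₁ (φ h))      ≈⟨ mk≈ (φ.homomorphism g h k (≈⇒Eq k≈gh)) ⟨
    proj₁ (φ k)                          ∎

wordElt : List (Fin 3) → GElt 4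
wordElt [] = one
wordElt (k ∷ w) = mul (sElt k) (wordElt w)

perm-wordElt : ∀ w i → perm (wordElt w) ⟨$⟩ʳ i ≡ act w i
perm-wordElt [] i = refl
perm-wordElt (k ∷ w) i = cong (sPerm k ⟨$⟩ʳ_) (perm-wordElt w i)

vec-wordElt : ∀ w i → vec (wordElt w) i ≡ 0ℤ
vec-wordElt [] i = refl
vec-wordElt (k ∷ w) i = cong (_+_ 0ℤ) (vec-wordElt w i)

module S₄Uniqueness (r p q : ℕ) {ψ φ : Rep r p 4 → Rep r p 4}
  (ψ-spec : PhiSpec r p q ψ) (φ-spec : PhiSpec r p q φ) where

  open Quotient r q
  open Modulo r
  open Agreement (proj₁ ψ-spec) (proj₁ φ-spec) public

  private
    D : ℤ
    D = + (r div q)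

    agree-through : ∀ {g} (x : GElt 4) → Eq[ r , q ] (proj₁ (ψ g)) x → Eq[ r , q ] (proj₁ (φ g)) x → Agree g
    agree-through {g} x ψg≈x φg≈x =
      ≈-trans (mk≈ {g = proj₁ (ψ g)} {h = x} ψg≈x) (≈-sym (mk≈ {g = proj₁ (φ g)} {h = x} φg≈x))

  agree-N : ∀ g → InN (proj₁ g) → Agree g
  agree-N g g∈N = agree-through (proj₁ g) (proj₂ (proj₂ ψ-spec) g g∈N) (proj₂ (proj₂ φ-spec) g g∈N)

  agree-s : ∀ k → Agree (sRep r p k)
  agree-s k with 2 ∣? (r div p)
  ... | yes 2∣r/p = agree-through (mul (tElt r (tIdx k)) (sElt k))
    (proj₁ (proj₁ (proj₂ ψ-spec) k) 2∣r/p) (proj₁ (proj₁ (proj₂ φ-spec) k) 2∣r/p)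
  ... | no 2∤r/p = agree-through (mul (mul (tElt r (tIdx k)) (sElt k)) (cpow (r div (2 ℕ.* q))))
    (proj₂ (proj₁ (proj₂ ψ-spec) k) 2∤r/p) (proj₂ (proj₁ (proj₂ φ-spec) k) 2∤r/p)

  wordRep : List (Fin 3) → Rep r p 4
  wordRep w = wordElt w , InG-zero r p (wordElt w) (vec-wordElt w)

  agree-word : ∀ w → Agree (wordRep w)
  agree-word [] = agree-N (wordRep []) (λ _ → refl)
  agree-word (k ∷ w) = agree-mul (sRep r p k) (wordRep w) (wordRep (k ∷ w)) ≈-refl (agree-s k) (agree-word w)

  permRep : Permutation′ 4 → Rep r p 4
  permRep π = permElt π , InG-zero r p (permElt π) (λ _ → refl)

  agree-perm : ∀ π → Agree (permRep π)
  agree-perm π = agree-≈ (permRep π) (wordRep w) π≈w (agree-word w)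
    where
    w = word (table π)
    π≈w : permElt π ≈ wordElt w
    π≈w = ≈-intro 0ℤ
      (λ i → sym (trans (trans (perm-wordElt w i) (word-act (table π) (table-injective π) i)) (table-⟪⟫ π i)))
      (λ i → ≋-reflexive (cong (_+ 0ℤ * D) (sym (vec-wordElt w i))))

  agree-all : ∀ g → Agree g
  agree-all g@((π , x) , g∈G) =
    agree-mul (permRep π) ((P.id , x) , g∈G) g g≈πx (agree-perm π) (agree-N ((P.id , x) , g∈G) (λ _ → refl))
    where
    g≈πx : (π , x) ≈ mul (permElt π) (P.id , x)
    g≈πx = ≈-intro 0ℤ (λ _ → refl) λ i → ≋-reflexive (pad (x i) D)
      where
      pad : ∀ a d → a ≡ 0ℤ + a + 0ℤ * d
      pad = solve-∀

-- Arithmetic of the parameters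

div-exact : ∀ {m k} n .{{_ : NonZero n}} → m ≡ k ℕ.* n → m div n ≡ k
div-exact {k = k} (suc n) refl = ℕ.m*n/n≡m k (suc n)

odd-decomposition : ∀ n → ¬ 2 ∣ n → n ≡ 1 ℕ.+ n ℕ./ 2 ℕ.* 2
odd-decomposition n 2∤n with n ℕ.% 2 in eq | ℕ.m%n<n n 2
... | 0 | _ = contradiction (m%n≡0⇒n∣m n 2 eq) 2∤n
... | 1 | _ = trans (ℕ.m≡m%n+[m/n]*n n 2) (cong (ℕ._+ n ℕ./ 2 ℕ.* 2) eq)
... | suc (suc _) | ℕ.s≤s (ℕ.s≤s ())

module _ {r p q : ℕ} .{{_ : NonZero p}} .{{_ : NonZero q}} (p∣r : p ∣ r) (q∣r : q ∣ r) (2∣q : 2 ∣ q) where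

  private
    a c h : ℕ
    a = quotient p∣r
    c = quotient q∣r
    h = quotient 2∣q

    r≡ap : r ≡ a ℕ.* p
    r≡ap = _∣_.equality p∣r

    r≡cq : r ≡ c ℕ.* q
    r≡cq = _∣_.equality q∣r

    r/p≡a : r div p ≡ a
    r/p≡a = div-exact p r≡ap

    r/q≡c : r div q ≡ c
    r/q≡c = div-exact q r≡cq

    r≡ch2 : r ≡ c ℕ.* h ℕ.* 2
    r≡ch2 = trans r≡cq (trans (cong (c ℕ.*_) (_∣_.equality 2∣q)) (sym (ℕ.*-assoc c h 2)))

    r/2≡ch : r div 2 ≡ c ℕ.* h
    r/2≡ch = div-exact 2 r≡ch2

    r≡H+H : + r ≡ + (r div 2) + + (r div 2)
    r≡H+H = trans (cong +_ r≡half+half) (ℤ.pos-+ (r div 2) (r div 2))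
      where
      r≡half+half : r ≡ r div 2 ℕ.+ r div 2
      r≡half+half = trans r≡ch2 (trans (ℕ.*-comm (c ℕ.* h) 2)
        (cong₂ ℕ._+_ (sym r/2≡ch) (trans (ℕ.+-identityʳ (c ℕ.* h)) (sym r/2≡ch))))

    H≡ηD : + (r div 2) ≡ + h * + (r div q)
    H≡ηD = trans (cong +_ (trans r/2≡ch (trans (ℕ.*-comm c h) (cong (h ℕ.*_) (sym r/q≡c)))))
                 (ℤ.pos-* h (r div q))

  even-parameters : 2 ∣ r div p → TwistParameters r p q 0ℤ
  even-parameters (divides a′ r/p≡a′2) = record
    { η = + h ; δ = 0ℤ ; τ = + a′
    ; r≡H+H = r≡H+H ; H≡ηD = H≡ηD ; S+S≡δD = refl
    ; H+4S≡τp = trans (ℤ.+-identityʳ (+ (r div 2))) (trans (cong +_ r/2≡a′p) (ℤ.pos-* a′ p))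
    }
    where
    open ≡-Reasoning
    swap : ∀ x y z → x ℕ.* y ℕ.* z ≡ x ℕ.* z ℕ.* y
    swap = ℕ-Solver.solve-∀
    r/2≡a′p : r div 2 ≡ a′ ℕ.* p
    r/2≡a′p = div-exact 2 (begin
      r                 ≡⟨ r≡ap ⟩
      a ℕ.* p           ≡⟨ cong (ℕ._* p) (trans (sym r/p≡a) r/p≡a′2) ⟩
      a′ ℕ.* 2 ℕ.* p    ≡⟨ swap a′ 2 p ⟩
      a′ ℕ.* p ℕ.* 2    ∎)

  odd-parameters : p ℕ.* q ∣ 4 ℕ.* r → ¬ 2 ∣ r div p →
                   2 ∣ r div q × ¬ 2 ∣ (4 ℕ.* r) div (p ℕ.* q) →
                   TwistParameters r p q (+ (r div (2 ℕ.* q)))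
  odd-parameters pq∣4r 2∤r/p (divides c′ r/q≡c′2 , 2∤4r/pq) = record
    { η = + h ; δ = 1ℤ ; τ = + τ
    ; r≡H+H = r≡H+H ; H≡ηD = H≡ηD
    ; S+S≡δD = begin
        + S + + S        ≡⟨ ℤ.pos-+ S S ⟨
        + (S ℕ.+ S)      ≡⟨ cong +_ S+S≡r/q ⟩
        + (r div q)      ≡⟨ ℤ.*-identityˡ (+ (r div q)) ⟨
        1ℤ * + (r div q) ∎
    ; H+4S≡τp = begin
        + (r div 2) + + S * + 4     ≡⟨ cong (_+_ (+ (r div 2))) (ℤ.pos-* S 4) ⟨
        + (r div 2) + + (S ℕ.* 4)   ≡⟨ ℤ.pos-+ (r div 2) (S ℕ.* 4) ⟨
        + (r div 2 ℕ.+ S ℕ.* 4)     ≡⟨ cong +_ r/2+4S≡τp ⟩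
        + (τ ℕ.* p)                 ≡⟨ ℤ.pos-* τ p ⟩
        + τ * + p                   ∎
    }
    where
    open ≡-Reasoning
    instance _ = ℕ.m*n≢0 2 q
    instance _ = ℕ.m*n≢0 p q

    b S τ : ℕ
    b = quotient pq∣4r
    S = r div (2 ℕ.* q)
    τ = suc (a ℕ./ 2 ℕ.+ b ℕ./ 2)

    c≡c′2 : c ≡ c′ ℕ.* 2
    c≡c′2 = trans (sym r/q≡c) r/q≡c′2

    S≡c′ : S ≡ c′
    S≡c′ = div-exact (2 ℕ.* q) (trans r≡cq (trans (cong (ℕ._* q) c≡c′2) (ℕ.*-assoc c′ 2 q)))

    S+S≡r/q : S ℕ.+ S ≡ r div q
    S+S≡r/q = trans (cong₂ ℕ._+_ S≡c′ S≡c′) (sym (trans r/q≡c (trans c≡c′2 (double c′))))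
      where
      double : ∀ x → x ℕ.* 2 ≡ x ℕ.+ x
      double = ℕ-Solver.solve-∀

    a≡1+2α : a ≡ 1 ℕ.+ a ℕ./ 2 ℕ.* 2
    a≡1+2α = odd-decomposition a λ 2∣a → 2∤r/p (subst (2 ∣_) (sym r/p≡a) 2∣a)

    b≡1+2β : b ≡ 1 ℕ.+ b ℕ./ 2 ℕ.* 2
    b≡1+2β = odd-decomposition b λ 2∣b →
      2∤4r/pq (subst (2 ∣_) (sym (div-exact (p ℕ.* q) (_∣_.equality pq∣4r))) 2∣b)

    8c′≡bp : c′ ℕ.* 8 ≡ b ℕ.* p
    8c′≡bp = ℕ.*-cancelʳ-≡ (c′ ℕ.* 8) (b ℕ.* p) q (begin
      c′ ℕ.* 8 ℕ.* q             ≡⟨ regroup c′ q ⟩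
      4 ℕ.* (c′ ℕ.* 2 ℕ.* q)     ≡⟨ cong (λ x → 4 ℕ.* (x ℕ.* q)) c≡c′2 ⟨
      4 ℕ.* (c ℕ.* q)            ≡⟨ cong (4 ℕ.*_) r≡cq ⟨
      4 ℕ.* r                    ≡⟨ _∣_.equality pq∣4r ⟩
      b ℕ.* (p ℕ.* q)            ≡⟨ ℕ.*-assoc b p q ⟨
      b ℕ.* p ℕ.* q              ∎)
      where
      regroup : ∀ x y → x ℕ.* 8 ℕ.* y ≡ 4 ℕ.* (x ℕ.* 2 ℕ.* y)
      regroup = ℕ-Solver.solve-∀

    r/2+4S≡τp : r div 2 ℕ.+ S ℕ.* 4 ≡ τ ℕ.* p
    r/2+4S≡τp = ℕ.*-cancelʳ-≡ _ _ 2 (begin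
      (r div 2 ℕ.+ S ℕ.* 4) ℕ.* 2       ≡⟨ cong (λ x → (r div 2 ℕ.+ x ℕ.* 4) ℕ.* 2) S≡c′ ⟩
      (r div 2 ℕ.+ c′ ℕ.* 4) ℕ.* 2      ≡⟨ expand (r div 2) c′ ⟩
      r div 2 ℕ.* 2 ℕ.+ c′ ℕ.* 8        ≡⟨ cong₂ ℕ._+_ (trans (cong (ℕ._* 2) r/2≡ch) (sym r≡ch2)) 8c′≡bp ⟩
      r ℕ.+ b ℕ.* p                     ≡⟨ cong (ℕ._+ b ℕ.* p) r≡ap ⟩
      a ℕ.* p ℕ.+ b ℕ.* p               ≡⟨ cong₂ (λ x y → x ℕ.* p ℕ.+ y ℕ.* p) a≡1+2α b≡1+2β ⟩
      (1 ℕ.+ a ℕ./ 2 ℕ.* 2) ℕ.* p ℕ.+ (1 ℕ.+ b ℕ./ 2 ℕ.* 2) ℕ.* p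
                                        ≡⟨ collect (a ℕ./ 2) (b ℕ./ 2) p ⟩
      τ ℕ.* p ℕ.* 2                     ∎)
      where
      expand : ∀ x y → (x ℕ.+ y ℕ.* 4) ℕ.* 2 ≡ x ℕ.* 2 ℕ.+ y ℕ.* 8
      expand = ℕ-Solver.solve-∀
      collect : ∀ α β p →
        (1 ℕ.+ α ℕ.* 2) ℕ.* p ℕ.+ (1 ℕ.+ β ℕ.* 2) ℕ.* p ≡ suc (α ℕ.+ β) ℕ.* p ℕ.* 2
      collect = ℕ-Solver.solve-∀

module _ {r p q : ℕ} where
  open Quotient r q

  unique-solution : Σ (Rep r p 4 → Rep r p 4) (PhiSpec r p q) →
    Σ (Rep r p 4 → Rep r p 4) λ φ →
      PhiSpec r p q φ × (∀ ψ → PhiSpec r p q ψ → ∀ g → Eq[ r , q ] (proj₁ (ψ g)) (proj₁ (φ g)))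
  unique-solution (φ , φ-spec) =
    φ , φ-spec , λ ψ ψ-spec g → ≈⇒Eq (S₄Uniqueness.agree-all r p q ψ-spec φ-spec g)

  even-solution : TwistParameters r p q 0ℤ → 2 ∣ r div p → Σ (Rep r p 4 → Rep r p 4) (PhiSpec r p q)
  even-solution params 2∣r/p = twistRep , twist-isAutomorphism
    , (λ k → (λ _ → ≈⇒Eq (≈-trans (twist-generator k) (mul-identityʳ (mul (tElt r (tIdx k)) (sElt k)))))
           , λ 2∤r/p → contradiction 2∣r/p 2∤r/p)
    , λ g g∈N → ≈⇒Eq (twist-diagonal (proj₁ g) g∈N)
    where open S₄Twist params

  odd-solution : TwistParameters r p q (+ (r div (2 ℕ.* q))) → ¬ 2 ∣ r div p →
                 Σ (Rep r p 4 → Rep r p 4) (PhiSpec r p q)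
  odd-solution params 2∤r/p = twistRep , twist-isAutomorphism
    , (λ k → (λ 2∣r/p → contradiction 2∣r/p 2∤r/p) , λ _ → ≈⇒Eq (twist-generator k))
    , λ g g∈N → ≈⇒Eq (twist-diagonal (proj₁ g) g∈N)
    where open S₄Twist params

proposition9p2 : (r p q : ℕ) → 0 < r → 0 < p → 0 < q
    → p ∣ r → q ∣ r → (p ℕ.* q) ∣ (4 ℕ.* r)
    → 2 ∣ q
    → (¬ (2 ∣ (r div p)) → (2 ∣ (r div q)) × ¬ (2 ∣ ((4 ℕ.* r) div (p ℕ.* q))))
    → Σ (Rep r p 4 → Rep r p 4) λ φ →
        PhiSpec r p q φ
        × (∀ ψ → PhiSpec r p q ψ → ∀ g → Eq[ r , q ] (proj₁ (ψ g)) (proj₁ (φ g)))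
proposition9p2 r p q _ 0<p 0<q p∣r q∣r pq∣4r 2∣q odd-case with 2 ∣? (r div p)
... | yes 2∣r/p = unique-solution (even-solution (even-parameters p∣r q∣r 2∣q 2∣r/p) 2∣r/p)
  where instance _ = ℕ.>-nonZero 0<p; _ = ℕ.>-nonZero 0<q
... | no 2∤r/p =
  unique-solution (odd-solution (odd-parameters p∣r q∣r 2∣q pq∣4r 2∤r/p (odd-case 2∤r/p)) 2∤r/p)
  where instance _ = ℕ.>-nonZero 0<p; _ = ℕ.>-nonZero 0<q
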